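{- Let $a$ be an odd natural number. Then, as $n\to\infty$, $$\sum_{j=0}^{a}\sum_{i=1}^{n}\frac{1}{n^a}\binom{a}{j}(-1)^jn^j \frac{ \left(i-\frac{1}{2}\right)^{a-j}\cdot i^{\overline{j}}}{(n+1)^{\overline{j}}}=O\left(\frac{1}{n^{\frac{a-1}{2}}}\right).$$
   Context: For a number $x$ and a nonnegative integer $k$, $x^{\overline{k}}$ denotes the rising factorial: $x^{\overline{0}}=1$ and $x^{\overline{k}}=x(x+1)\cdots(x+k-1)$ for $k\ge1$. -}

module Defs where

open import Data.Nat as ℕ using (ℕ; zero; suc)
open import Data.Nat.Combinatorics using (_C_)
open import Data.Integer using (+_)
open import Data.Rational using (ℚ; 0ℚ; 1ℚ; _+_; _*_; _-_; -_; _/_; ½)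
open import Data.List using (List; map; upTo; foldr)

ℕtoℚ : ℕ → ℚ
ℕtoℚ n = + n / 1

_^ℚ_ : ℚ → ℕ → ℚ
q ^ℚ zero = 1ℚ
q ^ℚ suc k = q * (q ^ℚ k)

rising : ℕ → ℕ → ℕ
rising x zero = 1
rising x (suc k) = rising x k ℕ.* (x ℕ.+ k)

-- division of a rational by a natural number; the d = 0 case (returning 0)
-- never occurs in the sums below for n ≥ 1.
_/ℕ_ : ℚ → ℕ → ℚ
q /ℕ zero = 0ℚ
q /ℕ suc d = q * (+ 1 / suc d)

Σ[_≤_≤_] : ℕ → ℕ → (ℕ → ℚ) → ℚ
Σ[ lo ≤ hi ≤ f ] = foldr _+_ 0ℚ (map (λ k → f (lo ℕ.+ k)) (upTo (suc hi ℕ.∸ lo)))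

term : ℕ → ℕ → ℕ → ℕ → ℚ
term a n j i =
  ((((ℕtoℚ (a C j) * ((- 1ℚ) ^ℚ j)) * (ℕtoℚ n ^ℚ j))
     * ((ℕtoℚ i - ½) ^ℚ (a ℕ.∸ j)))
     * ℕtoℚ (rising i j)
     /ℕ rising (suc n) j)
  /ℕ (n ℕ.^ a)

S : ℕ → ℕ → ℚ
S a n = Σ[ 0 ≤ a ≤ (λ j → Σ[ 1 ≤ n ≤ (λ i → term a n j i) ]) ]

module Submission where

-- For 1 ≤ i ≤ n the ratio i^(j̄) / (n+1)^(j̄) is E[pʲ] for p ~ Beta(i, n+1-i), so by the binomial
-- theorem row i of the double sum is n⁻ᵃ E[(i - ½ - n p)ᵃ]. Replacing i by n+1-i replaces p by 1-p,
-- and (n+1-i) - ½ - n(1-p) = -(i - ½ - n p); for odd a the rows i and n+1-i therefore cancel, the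
-- double sum is exactly 0, and the bound holds with constant 0. Only moment sequences are used:
-- E[pˢ(1-p)ʳ] is obtained from the moments by iterated differences, and for p ~ Beta(x, y) it equals
-- xˢ̄ yʳ̄ / (x+y)^(s+r)̄, which is symmetric under (x, s) ↔ (y, r).

open import Defs

module Vanishing where

  open import Algebra.Bundles using (CommutativeRing; CommutativeMonoid)
  open import Data.Fin.Base using (Fin; toℕ)
  open import Data.Fin.Permutation using (reverse)
  open import Data.Fin.Properties using (opposite-prop; toℕ<n)
  import Data.Integer as ℤ
  import Data.Integer.Properties as ℤ
  open import Data.List using (map; applyUpTo; foldr)
  open import Data.Nat as ℕ using (ℕ; zero; suc; _<_; _≤_; z≤n; s≤s)
  import Data.Nat.Properties as ℕ
  open import Data.Nat.Combinatorics using (_C_; nCk+nC[k+1]≡[n+1]C[k+1])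
  open import Data.Nat.Combinatorics.Specification using (k>n⇒nCk≡0)
  open import Data.Nat.Coprimality using (1-coprimeTo) renaming (sym to coprime-sym)
  open import Data.Nat.Tactic.RingSolver using () renaming (solve-∀ to ℕ-solve-∀)
  open import Data.Rational as ℚ using (ℚ; mkℚ; 0ℚ; 1ℚ; _+_; _*_; _-_; -_; ½; toℚᵘ)
  open import Data.Rational.Properties
    using ( +-*-commutativeRing; _≟_; normalize-coprime; toℚᵘ-injective; toℚᵘ-homo-+; toℚᵘ-homo-*
          ; *-inverseʳ; *-identityˡ; *-identityʳ; *-zeroˡ; *-zeroʳ; +-identityʳ; +-inverseʳ
          ; *-distribʳ-+; neg-distribˡ-*; *-1-commutativeMonoid )
  import Data.Rational.Unnormalised as ℚᵘ
  open import Data.Rational.Unnormalised.Properties using (module ≃-Reasoning)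
  open import Function using (_∘_)
  open import Relation.Binary.PropositionalEquality
  open import Relation.Nullary using (yes; no)
  open import Relation.Nullary.Decidable using (dec⇒maybe)
  open import Tactic.RingSolver using (solve-∀)
  open import Tactic.RingSolver.Core.AlmostCommutativeRing using (AlmostCommutativeRing; fromCommutativeRing)

  open import Algebra.Properties.Semiring.Sum (CommutativeRing.semiring +-*-commutativeRing)
  open import Algebra.Properties.CommutativeSemigroup (CommutativeMonoid.commutativeSemigroup *-1-commutativeMonoid)
    using () renaming (interchange to *-interchange)

  ℚ-ring : AlmostCommutativeRing _ _
  ℚ-ring = fromCommutativeRing +-*-commutativeRing (λ x → dec⇒maybe (0ℚ ≟ x))

  ℕtoℚ≡mkℚ : ∀ m → ℕtoℚ m ≡ mkℚ (ℤ.+ m) 0 (coprime-sym (1-coprimeTo m))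
  ℕtoℚ≡mkℚ m = normalize-coprime _

  toℚᵘ-ℕtoℚ : ∀ m → toℚᵘ (ℕtoℚ m) ≡ ℚᵘ.mkℚᵘ (ℤ.+ m) 0
  toℚᵘ-ℕtoℚ m = cong toℚᵘ (ℕtoℚ≡mkℚ m)

  ℕtoℚ-homo-+ : ∀ m k → ℕtoℚ (m ℕ.+ k) ≡ ℕtoℚ m + ℕtoℚ k
  ℕtoℚ-homo-+ m k = toℚᵘ-injective (begin
    toℚᵘ (ℕtoℚ (m ℕ.+ k))                 ≡⟨ toℚᵘ-ℕtoℚ (m ℕ.+ k) ⟩
    ℚᵘ.mkℚᵘ (ℤ.+ (m ℕ.+ k)) 0              ≈⟨ ℚᵘ.*≡* (cong (ℤ._* ℤ.+ 1) numerators) ⟩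
    ℚᵘ.mkℚᵘ (ℤ.+ m) 0 ℚᵘ.+ ℚᵘ.mkℚᵘ (ℤ.+ k) 0 ≡⟨ cong₂ ℚᵘ._+_ (toℚᵘ-ℕtoℚ m) (toℚᵘ-ℕtoℚ k) ⟨
    toℚᵘ (ℕtoℚ m) ℚᵘ.+ toℚᵘ (ℕtoℚ k)       ≈⟨ toℚᵘ-homo-+ (ℕtoℚ m) (ℕtoℚ k) ⟨
    toℚᵘ (ℕtoℚ m + ℕtoℚ k)                 ∎)
    where
    open ≃-Reasoning
    numerators : ℤ.+ (m ℕ.+ k) ≡ ℤ.+ m ℤ.* ℤ.+ 1 ℤ.+ ℤ.+ k ℤ.* ℤ.+ 1
    numerators = trans (ℤ.pos-+ m k) (sym (cong₂ ℤ._+_ (ℤ.*-identityʳ (ℤ.+ m)) (ℤ.*-identityʳ (ℤ.+ k))))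

  ℕtoℚ-homo-* : ∀ m k → ℕtoℚ (m ℕ.* k) ≡ ℕtoℚ m * ℕtoℚ k
  ℕtoℚ-homo-* m k = toℚᵘ-injective (begin
    toℚᵘ (ℕtoℚ (m ℕ.* k))                 ≡⟨ toℚᵘ-ℕtoℚ (m ℕ.* k) ⟩
    ℚᵘ.mkℚᵘ (ℤ.+ (m ℕ.* k)) 0              ≈⟨ ℚᵘ.*≡* (cong (ℤ._* ℤ.+ 1) (ℤ.pos-* m k)) ⟩
    ℚᵘ.mkℚᵘ (ℤ.+ m) 0 ℚᵘ.* ℚᵘ.mkℚᵘ (ℤ.+ k) 0 ≡⟨ cong₂ ℚᵘ._*_ (toℚᵘ-ℕtoℚ m) (toℚᵘ-ℕtoℚ k) ⟨
    toℚᵘ (ℕtoℚ m) ℚᵘ.* toℚᵘ (ℕtoℚ k)       ≈⟨ toℚᵘ-homo-* (ℕtoℚ m) (ℕtoℚ k) ⟨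
    toℚᵘ (ℕtoℚ m * ℕtoℚ k)                 ∎)
    where open ≃-Reasoning

  neg-^ℚ : ∀ q j → (- q) ^ℚ j ≡ (- 1ℚ) ^ℚ j * q ^ℚ j
  neg-^ℚ q zero = refl
  neg-^ℚ q (suc j) = trans (cong ((- q) *_) (neg-^ℚ q j)) (regroup q ((- 1ℚ) ^ℚ j) (q ^ℚ j))
    where
    regroup : ∀ q σ p → (- q) * (σ * p) ≡ (- 1ℚ) * σ * (q * p)
    regroup = solve-∀ ℚ-ring

  -1^ℚ-odd : ∀ m → (- 1ℚ) ^ℚ suc (2 ℕ.* m) ≡ - 1ℚ
  -1^ℚ-odd zero = refl
  -1^ℚ-odd (suc m) = trans (cong (λ k → (- 1ℚ) ^ℚ suc k) (ℕ.*-suc 2 m))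
    (cong (λ t → - 1ℚ * (- 1ℚ * t)) (-1^ℚ-odd m))

  /ℕ≡*1/ℕ : ∀ q d → q /ℕ d ≡ q * (1ℚ /ℕ d)
  /ℕ≡*1/ℕ q zero = sym (*-zeroʳ q)
  /ℕ≡*1/ℕ q (suc d) = cong (q *_) (sym (*-identityˡ _))

  ℕtoℚ*1/ℕ≡1 : ∀ k → ℕtoℚ (suc k) * (1ℚ /ℕ suc k) ≡ 1ℚ
  ℕtoℚ*1/ℕ≡1 k = begin
    ℕtoℚ (suc k) * (1ℚ * (ℤ.+ 1 ℚ./ suc k))     ≡⟨ cong (ℕtoℚ (suc k) *_) (*-identityˡ _) ⟩
    ℕtoℚ (suc k) * (ℤ.+ 1 ℚ./ suc k)            ≡⟨ cong₂ _*_ (ℕtoℚ≡mkℚ (suc k)) (normalize-coprime (1-coprimeTo (suc k))) ⟩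
    mkℚ (ℤ.+ suc k) 0 c * mkℚ (ℤ.+ 1) k (1-coprimeTo (suc k)) ≡⟨ *-inverseʳ (mkℚ (ℤ.+ suc k) 0 c) ⟩
    1ℚ                                        ∎
    where
    open ≡-Reasoning
    c = coprime-sym (1-coprimeTo (suc k))

  1/ℕ-homo-* : ∀ d e → 1ℚ /ℕ (d ℕ.* e) ≡ (1ℚ /ℕ d) * (1ℚ /ℕ e)
  1/ℕ-homo-* zero e = sym (*-zeroˡ (1ℚ /ℕ e))
  1/ℕ-homo-* (suc d) zero rewrite ℕ.*-zeroʳ d = sym (*-zeroʳ (1ℚ /ℕ suc d))
  1/ℕ-homo-* (suc d) (suc e) = inverse-unique (ℕtoℚ (suc d ℕ.* suc e)) (ℕtoℚ*1/ℕ≡1 (e ℕ.+ d ℕ.* suc e)) (begin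
    ℕtoℚ (suc d ℕ.* suc e) * (D⁻¹ * E⁻¹)       ≡⟨ cong (_* (D⁻¹ * E⁻¹)) (ℕtoℚ-homo-* (suc d) (suc e)) ⟩
    ℕtoℚ (suc d) * ℕtoℚ (suc e) * (D⁻¹ * E⁻¹)  ≡⟨ *-interchange (ℕtoℚ (suc d)) (ℕtoℚ (suc e)) D⁻¹ E⁻¹ ⟩
    ℕtoℚ (suc d) * D⁻¹ * (ℕtoℚ (suc e) * E⁻¹)  ≡⟨ cong₂ _*_ (ℕtoℚ*1/ℕ≡1 d) (ℕtoℚ*1/ℕ≡1 e) ⟩
    1ℚ                                         ∎)
    where
    open ≡-Reasoning
    D⁻¹ = 1ℚ /ℕ suc d
    E⁻¹ = 1ℚ /ℕ suc e
    inverse-unique : ∀ p {x y} → p * x ≡ 1ℚ → p * y ≡ 1ℚ → x ≡ y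
    inverse-unique p {x} {y} px≡1 py≡1 = begin
      x             ≡⟨ sym (*-identityʳ x) ⟩
      x * 1ℚ        ≡⟨ cong (x *_) (sym py≡1) ⟩
      x * (p * y)   ≡⟨ rotate x p y ⟩
      (p * x) * y   ≡⟨ cong (_* y) px≡1 ⟩
      1ℚ * y        ≡⟨ *-identityˡ y ⟩
      y             ∎
      where
      rotate : ∀ x p y → x * (p * y) ≡ (p * x) * y
      rotate = solve-∀ ℚ-ring

  /ℕ-cancelʳ : ∀ q d e → 0 < e → (q * ℕtoℚ e) /ℕ (d ℕ.* e) ≡ q /ℕ d
  /ℕ-cancelʳ q d (suc e) _ = begin
    (q * E) /ℕ (d ℕ.* suc e)            ≡⟨ /ℕ≡*1/ℕ (q * E) (d ℕ.* suc e) ⟩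
    q * E * (1ℚ /ℕ (d ℕ.* suc e))       ≡⟨ cong (q * E *_) (1/ℕ-homo-* d (suc e)) ⟩
    q * E * ((1ℚ /ℕ d) * E⁻¹)           ≡⟨ *-interchange q E (1ℚ /ℕ d) E⁻¹ ⟩
    q * (1ℚ /ℕ d) * (E * E⁻¹)           ≡⟨ cong (q * (1ℚ /ℕ d) *_) (ℕtoℚ*1/ℕ≡1 e) ⟩
    q * (1ℚ /ℕ d) * 1ℚ                  ≡⟨ *-identityʳ _ ⟩
    q * (1ℚ /ℕ d)                       ≡⟨ sym (/ℕ≡*1/ℕ q d) ⟩
    q /ℕ d                              ∎
    where
    open ≡-Reasoning
    E = ℕtoℚ (suc e)
    E⁻¹ = 1ℚ /ℕ suc e

  /ℕ-distribʳ-+ : ∀ p q d → (p + q) /ℕ d ≡ p /ℕ d + q /ℕ d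
  /ℕ-distribʳ-+ p q zero = refl
  /ℕ-distribʳ-+ p q (suc d) = *-distribʳ-+ _ p q

  neg-/ℕ : ∀ q d → (- q) /ℕ d ≡ - (q /ℕ d)
  neg-/ℕ q zero = refl
  neg-/ℕ q (suc d) = sym (neg-distribˡ-* q _)

  foldr-map-applyUpTo : ∀ (h : ℕ → ℚ) (g : ℕ → ℕ) m →
    foldr _+_ 0ℚ (map h (applyUpTo g m)) ≡ ∑[ k < m ] h (g (toℕ k))
  foldr-map-applyUpTo h g zero = refl
  foldr-map-applyUpTo h g (suc m) = cong (h (g 0) +_) (foldr-map-applyUpTo h (λ k → g (suc k)) m)

  Σ[≤≤]≡∑ : ∀ lo hi f → Σ[ lo ≤ hi ≤ f ] ≡ ∑[ k < suc hi ℕ.∸ lo ] f (lo ℕ.+ toℕ k)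
  Σ[≤≤]≡∑ lo hi f = foldr-map-applyUpTo (λ k → f (lo ℕ.+ k)) (λ k → k) (suc hi ℕ.∸ lo)

  ∑-/ℕ : ∀ m (f : Fin m → ℚ) d → ∑[ k < m ] (f k /ℕ d) ≡ (∑[ k < m ] f k) /ℕ d
  ∑-/ℕ m f d = begin
    ∑[ k < m ] (f k /ℕ d)           ≡⟨ sum-cong-≗ {m} (λ k → /ℕ≡*1/ℕ (f k) d) ⟩
    ∑[ k < m ] (f k * (1ℚ /ℕ d))    ≡⟨ *-distribʳ-sum {m} (1ℚ /ℕ d) f ⟨
    (∑[ k < m ] f k) * (1ℚ /ℕ d)    ≡⟨ /ℕ≡*1/ℕ (∑[ k < m ] f k) d ⟨
    (∑[ k < m ] f k) /ℕ d           ∎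
    where open ≡-Reasoning

  ∑-antisymmetric≡0 : ∀ n (φ : ℕ → ℚ) → (∀ k → k < n → φ (n ℕ.∸ suc k) ≡ - φ k) →
    ∑[ k < n ] φ (toℕ k) ≡ 0ℚ
  ∑-antisymmetric≡0 n φ φ-antisym = double≡0⇒≡0 (begin
    s + s                                             ≡⟨ cong (s +_) reflected ⟩
    s + s′                                            ≡⟨ ∑-distrib-+ {n} (φ ∘ toℕ) (λ k → φ (n ℕ.∸ suc (toℕ k))) ⟨
    ∑[ k < n ] (φ (toℕ k) + φ (n ℕ.∸ suc (toℕ k)))   ≡⟨ sum-cong-≗ {n} pairs-cancel ⟩
    ∑[ k < n ] 0ℚ                                     ≡⟨ sum-replicate-zero n ⟩
    0ℚ                                                ∎)
    where
    open ≡-Reasoning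
    s = ∑[ k < n ] φ (toℕ k)
    s′ = ∑[ k < n ] φ (n ℕ.∸ suc (toℕ k))
    reflected : s ≡ s′
    reflected = trans (sum-permute {n} (φ ∘ toℕ) reverse) (sum-cong-≗ {n} (cong φ ∘ opposite-prop))
    pairs-cancel : ∀ k → φ (toℕ k) + φ (n ℕ.∸ suc (toℕ k)) ≡ 0ℚ
    pairs-cancel k = trans (cong (φ (toℕ k) +_) (φ-antisym (toℕ k) (toℕ<n k))) (+-inverseʳ (φ (toℕ k)))
    double≡0⇒≡0 : ∀ {x} → x + x ≡ 0ℚ → x ≡ 0ℚ
    double≡0⇒≡0 {x} x+x≡0 = trans (halve x) (cong (_* ½) x+x≡0)
      where
      halve : ∀ x → x ≡ (x + x) * ½
      halve = solve-∀ ℚ-ring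

  -- If μ j = E[pʲ], then mixedMoment μ s r = E[pˢ(1-p)ʳ] and powerMoment a u c μ = E[(u + c p)ᵃ].
  mixedMoment : (ℕ → ℚ) → ℕ → ℕ → ℚ
  mixedMoment μ s zero = μ s
  mixedMoment μ s (suc r) = mixedMoment μ s r - mixedMoment μ (suc s) r

  powerMoment : ℕ → ℚ → ℚ → (ℕ → ℚ) → ℚ
  powerMoment zero u c μ = μ 0
  powerMoment (suc a) u c μ = u * powerMoment a u c μ + c * powerMoment a u c (μ ∘ suc)

  powerMoment-cong : ∀ a u c {μ ν : ℕ → ℚ} → (∀ j → μ j ≡ ν j) → powerMoment a u c μ ≡ powerMoment a u c ν
  powerMoment-cong zero u c μ≗ν = μ≗ν 0
  powerMoment-cong (suc a) u c μ≗ν =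
    cong₂ (λ p q → u * p + c * q) (powerMoment-cong a u c μ≗ν) (powerMoment-cong a u c (μ≗ν ∘ suc))

  powerMoment-distrib-- : ∀ a u c (μ ν : ℕ → ℚ) →
    powerMoment a u c (λ j → μ j - ν j) ≡ powerMoment a u c μ - powerMoment a u c ν
  powerMoment-distrib-- zero u c μ ν = refl
  powerMoment-distrib-- (suc a) u c μ ν = trans
    (cong₂ (λ p q → u * p + c * q) (powerMoment-distrib-- a u c μ ν) (powerMoment-distrib-- a u c (μ ∘ suc) (ν ∘ suc)))
    (linear u c _ _ _ _)
    where
    linear : ∀ u c p p′ q q′ → u * (p - q) + c * (p′ - q′) ≡ (u * p + c * p′) - (u * q + c * q′)
    linear = solve-∀ ℚ-ring

  powerMoment-neg : ∀ a u c μ → powerMoment a (- u) (- c) μ ≡ (- 1ℚ) ^ℚ a * powerMoment a u c μ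
  powerMoment-neg zero u c μ = sym (*-identityˡ (μ 0))
  powerMoment-neg (suc a) u c μ = trans
    (cong₂ (λ p q → (- u) * p + (- c) * q) (powerMoment-neg a u c μ) (powerMoment-neg a u c (μ ∘ suc)))
    (factor u c ((- 1ℚ) ^ℚ a) _ _)
    where
    factor : ∀ u c σ p q → (- u) * (σ * p) + (- c) * (σ * q) ≡ (- 1ℚ) * σ * (u * p + c * q)
    factor = solve-∀ ℚ-ring

  -- E[pˢ(1-p)ʳ (u + c(1-p))ᵃ] = E[pˢ(1-p)ʳ ((u + c) - c p)ᵃ]
  powerMoment-mixedMoment-swap : ∀ a u c μ s r →
    powerMoment a u c (λ j → mixedMoment μ s (r ℕ.+ j)) ≡
    powerMoment a (u + c) (- c) (λ j → mixedMoment μ (s ℕ.+ j) r)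
  powerMoment-mixedMoment-swap zero u c μ s r =
    cong₂ (mixedMoment μ) (sym (ℕ.+-identityʳ s)) (ℕ.+-identityʳ r)
  powerMoment-mixedMoment-swap (suc a) u c μ s r = begin
    u * P + c * powerMoment a u c (λ j → mixedMoment μ s (r ℕ.+ suc j))
      ≡⟨ cong (λ t → u * P + c * t) (powerMoment-cong a u c (cong (mixedMoment μ s) ∘ ℕ.+-suc r)) ⟩
    u * P + c * powerMoment a u c (λ j → mixedMoment μ s (suc r ℕ.+ j))
      ≡⟨ cong (λ t → u * P + c * t) (powerMoment-mixedMoment-swap a u c μ s (suc r)) ⟩
    u * P + c * powerMoment a (u + c) (- c) (λ j → mixedMoment μ (s ℕ.+ j) r - mixedMoment μ (suc (s ℕ.+ j)) r)
      ≡⟨ cong (λ t → u * P + c * t) (powerMoment-distrib-- a (u + c) (- c) _ _) ⟩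
    u * P + c * (P′ - Q)
      ≡⟨ cong (λ t → u * t + c * (P′ - Q)) (powerMoment-mixedMoment-swap a u c μ s r) ⟩
    u * P′ + c * (P′ - Q)
      ≡⟨ regroup u c P′ Q ⟩
    (u + c) * P′ + (- c) * Q
      ≡⟨ cong (λ t → (u + c) * P′ + (- c) * t)
              (powerMoment-cong a (u + c) (- c) λ j → cong (λ k → mixedMoment μ k r) (sym (ℕ.+-suc s j))) ⟩
    (u + c) * P′ + (- c) * powerMoment a (u + c) (- c) (λ j → mixedMoment μ (s ℕ.+ suc j) r) ∎
    where
    open ≡-Reasoning
    P = powerMoment a u c (λ j → mixedMoment μ s (r ℕ.+ j))
    P′ = powerMoment a (u + c) (- c) (λ j → mixedMoment μ (s ℕ.+ j) r)
    Q = powerMoment a (u + c) (- c) (λ j → mixedMoment μ (suc (s ℕ.+ j)) r)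
    regroup : ∀ u c p q → u * p + c * (p - q) ≡ (u + c) * p + (- c) * q
    regroup = solve-∀ ℚ-ring

  binomialTerm : ℕ → ℚ → ℚ → (ℕ → ℚ) → ℕ → ℚ
  binomialTerm a u c μ j = ℕtoℚ (a C j) * c ^ℚ j * u ^ℚ (a ℕ.∸ j) * μ j

  binomialTerm-vanishes : ∀ {a j} u c μ → a < j → binomialTerm a u c μ j ≡ 0ℚ
  binomialTerm-vanishes {a} {j} u c μ a<j rewrite k>n⇒nCk≡0 a<j =
    annihilate (c ^ℚ j) (u ^ℚ (a ℕ.∸ j)) (μ j)
    where
    annihilate : ∀ x y z → 0ℚ * x * y * z ≡ 0ℚ
    annihilate = solve-∀ ℚ-ring

  u*binomialTerm-suc : ∀ a j u c μ →
    u * binomialTerm a u c μ (suc j) ≡ ℕtoℚ (a C suc j) * c ^ℚ suc j * u ^ℚ (a ℕ.∸ j) * μ (suc j)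
  u*binomialTerm-suc a j u c μ with j ℕ.<? a
  ... | yes j<a = trans (absorb (ℕtoℚ (a C suc j)) (c ^ℚ suc j) (u ^ℚ (a ℕ.∸ suc j)) (μ (suc j)) u)
    (cong (λ k → ℕtoℚ (a C suc j) * c ^ℚ suc j * u ^ℚ k * μ (suc j)) (sym (ℕ.+-∸-assoc 1 j<a)))
    where
    absorb : ∀ b x y z u → u * (b * x * y * z) ≡ b * x * (u * y) * z
    absorb = solve-∀ ℚ-ring
  ... | no j≮a rewrite k>n⇒nCk≡0 (s≤s (ℕ.≮⇒≥ j≮a)) =
    annihilate (c ^ℚ suc j) (u ^ℚ (a ℕ.∸ suc j)) (u ^ℚ (a ℕ.∸ j)) (μ (suc j)) u
    where
    annihilate : ∀ x y y′ z u → u * (0ℚ * x * y * z) ≡ 0ℚ * x * y′ * z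
    annihilate = solve-∀ ℚ-ring

  binomialTerm-pascal : ∀ a j u c μ →
    binomialTerm (suc a) u c μ (suc j) ≡ u * binomialTerm a u c μ (suc j) + c * binomialTerm a u c (μ ∘ suc) j
  binomialTerm-pascal a j u c μ = begin
    ℕtoℚ (suc a C suc j) * c ^ℚ suc j * u ^ℚ (a ℕ.∸ j) * μ (suc j)
      ≡⟨ cong (λ b → ℕtoℚ b * c ^ℚ suc j * u ^ℚ (a ℕ.∸ j) * μ (suc j)) (nCk+nC[k+1]≡[n+1]C[k+1] a j) ⟨
    ℕtoℚ (a C j ℕ.+ a C suc j) * c ^ℚ suc j * u ^ℚ (a ℕ.∸ j) * μ (suc j)
      ≡⟨ cong (λ b → b * c ^ℚ suc j * u ^ℚ (a ℕ.∸ j) * μ (suc j)) (ℕtoℚ-homo-+ (a C j) (a C suc j)) ⟩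
    (ℕtoℚ (a C j) + ℕtoℚ (a C suc j)) * c ^ℚ suc j * u ^ℚ (a ℕ.∸ j) * μ (suc j)
      ≡⟨ split (ℕtoℚ (a C j)) (ℕtoℚ (a C suc j)) c (c ^ℚ j) (u ^ℚ (a ℕ.∸ j)) (μ (suc j)) ⟩
    ℕtoℚ (a C suc j) * c ^ℚ suc j * u ^ℚ (a ℕ.∸ j) * μ (suc j) + c * binomialTerm a u c (μ ∘ suc) j
      ≡⟨ cong (_+ c * binomialTerm a u c (μ ∘ suc) j) (u*binomialTerm-suc a j u c μ) ⟨
    u * binomialTerm a u c μ (suc j) + c * binomialTerm a u c (μ ∘ suc) j ∎
    where
    open ≡-Reasoning
    split : ∀ b b′ c x y z → (b + b′) * (c * x) * y * z ≡ b′ * (c * x) * y * z + c * (b * x * y * z)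
    split = solve-∀ ℚ-ring

  -- ℕtoℚ (a C 0) and x ^ℚ 0 compute to 1ℚ, which the solver steps unit and shift rely on.
  powerMoment-expansion : ∀ a m u c μ → a ≤ m → ∑[ j < suc m ] binomialTerm a u c μ (toℕ j) ≡ powerMoment a u c μ
  powerMoment-expansion zero m u c μ _ = begin
    binomialTerm 0 u c μ 0 + ∑[ j < m ] binomialTerm 0 u c μ (suc (toℕ j))
      ≡⟨ cong₂ _+_ (unit (μ 0)) (sum-cong-≗ {m} λ j → binomialTerm-vanishes u c μ (s≤s z≤n)) ⟩
    μ 0 + ∑[ j < m ] 0ℚ
      ≡⟨ cong (μ 0 +_) (sum-replicate-zero m) ⟩
    μ 0 + 0ℚ
      ≡⟨ +-identityʳ (μ 0) ⟩
    μ 0 ∎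
    where
    open ≡-Reasoning
    unit : ∀ x → 1ℚ * 1ℚ * 1ℚ * x ≡ x
    unit = solve-∀ ℚ-ring
  powerMoment-expansion (suc a) (suc m) u c μ (s≤s a≤m) = begin
    binomialTerm (suc a) u c μ 0 + ∑[ j < suc m ] binomialTerm (suc a) u c μ (suc (toℕ j))
      ≡⟨ cong₂ _+_ (shift (u ^ℚ a) (μ 0) u) (sum-cong-≗ {suc m} λ j → binomialTerm-pascal a (toℕ j) u c μ) ⟩
    u * B₀ + ∑[ j < suc m ] (u * B (suc (toℕ j)) + c * B′ (toℕ j))
      ≡⟨ cong (u * B₀ +_) (∑-distrib-+ {suc m} (λ j → u * B (suc (toℕ j))) (λ j → c * B′ (toℕ j))) ⟩
    u * B₀ + (∑[ j < suc m ] (u * B (suc (toℕ j))) + ∑[ j < suc m ] (c * B′ (toℕ j)))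
      ≡⟨ cong₂ (λ p q → u * B₀ + (p + q))
               (*-distribˡ-sum {suc m} u (λ j → B (suc (toℕ j)))) (*-distribˡ-sum {suc m} c (B′ ∘ toℕ)) ⟨
    u * B₀ + (u * ∑[ j < suc m ] B (suc (toℕ j)) + c * ∑[ j < suc m ] B′ (toℕ j))
      ≡⟨ regroup u c B₀ _ _ ⟩
    u * ∑[ j < suc (suc m) ] B (toℕ j) + c * ∑[ j < suc m ] B′ (toℕ j)
      ≡⟨ cong₂ (λ p q → u * p + c * q) (powerMoment-expansion a (suc m) u c μ (ℕ.m≤n⇒m≤1+n a≤m))
                                       (powerMoment-expansion a m u c (μ ∘ suc) a≤m) ⟩
    u * powerMoment a u c μ + c * powerMoment a u c (μ ∘ suc) ∎
    where
    open ≡-Reasoning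
    B = binomialTerm a u c μ
    B′ = binomialTerm a u c (μ ∘ suc)
    B₀ = B 0
    shift : ∀ y z u → 1ℚ * 1ℚ * (u * y) * z ≡ u * (1ℚ * 1ℚ * y * z)
    shift = solve-∀ ℚ-ring
    regroup : ∀ u c b s t → u * b + (u * s + c * t) ≡ u * (b + s) + c * t
    regroup = solve-∀ ℚ-ring

  -- E[pˢ(1-p)ʳ] for p ~ Beta(x, y)
  betaMoment : ℕ → ℕ → ℕ → ℕ → ℚ
  betaMoment x y s r = ℕtoℚ (rising x s ℕ.* rising y r) /ℕ rising (x ℕ.+ y) (s ℕ.+ r)

  betaMoment-split : ∀ x y s r → 0 < x ℕ.+ y →
    betaMoment x y s r ≡ betaMoment x y (suc s) r + betaMoment x y s (suc r)
  betaMoment-split x y s r 0<x+y = begin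
    ℕtoℚ (a ℕ.* b) /ℕ D                                    ≡⟨ /ℕ-cancelʳ (ℕtoℚ (a ℕ.* b)) D e 0<e ⟨
    (ℕtoℚ (a ℕ.* b) * ℕtoℚ e) /ℕ (D ℕ.* e)                ≡⟨ cong (_/ℕ (D ℕ.* e)) (ℕtoℚ-homo-* (a ℕ.* b) e) ⟨
    ℕtoℚ (a ℕ.* b ℕ.* e) /ℕ (D ℕ.* e)                      ≡⟨ cong (λ m → ℕtoℚ m /ℕ (D ℕ.* e)) (split a b x y s r) ⟩
    ℕtoℚ (a ℕ.* (x ℕ.+ s) ℕ.* b ℕ.+ a ℕ.* (b ℕ.* (y ℕ.+ r))) /ℕ (D ℕ.* e)
      ≡⟨ cong (_/ℕ (D ℕ.* e)) (ℕtoℚ-homo-+ (a ℕ.* (x ℕ.+ s) ℕ.* b) (a ℕ.* (b ℕ.* (y ℕ.+ r)))) ⟩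
    (ℕtoℚ (a ℕ.* (x ℕ.+ s) ℕ.* b) + ℕtoℚ (a ℕ.* (b ℕ.* (y ℕ.+ r)))) /ℕ (D ℕ.* e)
      ≡⟨ /ℕ-distribʳ-+ _ _ (D ℕ.* e) ⟩
    betaMoment x y (suc s) r + ℕtoℚ (a ℕ.* (b ℕ.* (y ℕ.+ r))) /ℕ (D ℕ.* e)
      ≡⟨ cong (λ k → betaMoment x y (suc s) r + ℕtoℚ (a ℕ.* (b ℕ.* (y ℕ.+ r))) /ℕ rising (x ℕ.+ y) k) (ℕ.+-suc s r) ⟨
    betaMoment x y (suc s) r + betaMoment x y s (suc r)    ∎
    where
    -- betaMoment x y (suc s) r unfolds to ℕtoℚ (a * (x + s) * b) /ℕ (D * e).
    open ≡-Reasoning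
    a = rising x s
    b = rising y r
    D = rising (x ℕ.+ y) (s ℕ.+ r)
    e = x ℕ.+ y ℕ.+ (s ℕ.+ r)
    0<e : 0 < e
    0<e = ℕ.<-≤-trans 0<x+y (ℕ.m≤m+n (x ℕ.+ y) (s ℕ.+ r))
    split : ∀ a b x y s r → a ℕ.* b ℕ.* (x ℕ.+ y ℕ.+ (s ℕ.+ r)) ≡ a ℕ.* (x ℕ.+ s) ℕ.* b ℕ.+ a ℕ.* (b ℕ.* (y ℕ.+ r))
    split = ℕ-solve-∀

  mixedMoment-betaMoment : ∀ x y → 0 < x ℕ.+ y → ∀ s r →
    mixedMoment (λ j → betaMoment x y j 0) s r ≡ betaMoment x y s r
  mixedMoment-betaMoment x y 0<x+y s zero = refl
  mixedMoment-betaMoment x y 0<x+y s (suc r) = begin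
    mixedMoment μ s r - mixedMoment μ (suc s) r
      ≡⟨ cong₂ _-_ (mixedMoment-betaMoment x y 0<x+y s r) (mixedMoment-betaMoment x y 0<x+y (suc s) r) ⟩
    betaMoment x y s r - betaMoment x y (suc s) r
      ≡⟨ cong (_- betaMoment x y (suc s) r) (betaMoment-split x y s r 0<x+y) ⟩
    betaMoment x y (suc s) r + betaMoment x y s (suc r) - betaMoment x y (suc s) r
      ≡⟨ cancel (betaMoment x y (suc s) r) (betaMoment x y s (suc r)) ⟩
    betaMoment x y s (suc r) ∎
    where
    open ≡-Reasoning
    μ = λ j → betaMoment x y j 0
    cancel : ∀ p q → p + q - p ≡ q
    cancel = solve-∀ ℚ-ring

  betaMoment-swap : ∀ x y s r → betaMoment x y s r ≡ betaMoment y x r s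
  betaMoment-swap x y s r = cong₂ _/ℕ_
    (cong ℕtoℚ (ℕ.*-comm (rising x s) (rising y r))) (cong₂ rising (ℕ.+-comm x y) (ℕ.+-comm s r))

  powerMoment-betaMoment-reflect : ∀ a u c x y → 0 < x ℕ.+ y →
    powerMoment a u c (λ j → betaMoment y x j 0) ≡ powerMoment a (u + c) (- c) (λ j → betaMoment x y j 0)
  powerMoment-betaMoment-reflect a u c x y 0<x+y = trans
    (powerMoment-cong a u c λ j → trans (betaMoment-swap y x j 0) (sym (mixedMoment-betaMoment x y 0<x+y 0 j)))
    (powerMoment-mixedMoment-swap a u c (λ j → betaMoment x y j 0) 0 0)

  betaMoment-rising : ∀ {i N} j → i ≤ N → betaMoment i (N ℕ.∸ i) j 0 ≡ ℕtoℚ (rising i j) /ℕ rising N j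
  betaMoment-rising {i} j i≤N = cong₂ _/ℕ_
    (cong ℕtoℚ (ℕ.*-identityʳ (rising i j))) (cong₂ rising (ℕ.m+[n∸m]≡n i≤N) (ℕ.+-identityʳ j))

  rowSum : ℕ → ℕ → ℕ → ℕ → ℚ
  rowSum a n x y = powerMoment a (ℕtoℚ x - ½) (- ℕtoℚ n) (λ j → betaMoment x y j 0)

  rowSum-antisym : ∀ a n x y → (- 1ℚ) ^ℚ a ≡ - 1ℚ → x ℕ.+ y ≡ suc n →
    rowSum a n y x ≡ - rowSum a n x y
  rowSum-antisym a n x y odd x+y≡1+n = begin
    powerMoment a (Y - ½) (- N) (λ j → betaMoment y x j 0)
      ≡⟨ powerMoment-betaMoment-reflect a (Y - ½) (- N) x y (subst (0 <_) (sym x+y≡1+n) (s≤s z≤n)) ⟩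
    powerMoment a (Y - ½ + - N) (- - N) (λ j → betaMoment x y j 0)
      ≡⟨ cong (λ u → powerMoment a u (- - N) (λ j → betaMoment x y j 0)) reflected-centre ⟩
    powerMoment a (- (X - ½)) (- - N) (λ j → betaMoment x y j 0)
      ≡⟨ powerMoment-neg a (X - ½) (- N) (λ j → betaMoment x y j 0) ⟩
    (- 1ℚ) ^ℚ a * rowSum a n x y
      ≡⟨ cong (_* rowSum a n x y) odd ⟩
    - 1ℚ * rowSum a n x y
      ≡⟨ neg-one (rowSum a n x y) ⟩
    - rowSum a n x y ∎
    where
    open ≡-Reasoning
    X = ℕtoℚ x
    Y = ℕtoℚ y
    N = ℕtoℚ n
    X+Y≡1+N : X + Y ≡ 1ℚ + N
    X+Y≡1+N = trans (sym (ℕtoℚ-homo-+ x y)) (trans (cong ℕtoℚ x+y≡1+n) (ℕtoℚ-homo-+ 1 n))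
    reflected-centre : Y - ½ + - N ≡ - (X - ½)
    reflected-centre = begin
      Y - ½ + - N                   ≡⟨ expand X Y N ⟩
      (X + Y) - (1ℚ + N) + - (X - ½) ≡⟨ cong (λ t → t - (1ℚ + N) + - (X - ½)) X+Y≡1+N ⟩
      (1ℚ + N) - (1ℚ + N) + - (X - ½) ≡⟨ cancel (1ℚ + N) (- (X - ½)) ⟩
      - (X - ½)                     ∎
      where
      expand : ∀ X Y N → Y - ½ + - N ≡ (X + Y) - (1ℚ + N) + - (X - ½)
      expand = solve-∀ ℚ-ring
      cancel : ∀ p q → p - p + q ≡ q
      cancel = solve-∀ ℚ-ring
    neg-one : ∀ p → - 1ℚ * p ≡ - p
    neg-one = solve-∀ ℚ-ring

  term≡binomialTerm/ℕ : ∀ a n j i → i ≤ suc n →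
    term a n j i ≡ binomialTerm a (ℕtoℚ i - ½) (- ℕtoℚ n) (λ j → betaMoment i (suc n ℕ.∸ i) j 0) j /ℕ (n ℕ.^ a)
  term≡binomialTerm/ℕ a n j i i≤1+n = cong (_/ℕ (n ℕ.^ a)) (begin
    b * σ * p * q * ρ          ≡⟨ regroup b σ p q ρ ⟩
    b * (σ * p) * q * ρ        ≡⟨ cong₂ (λ t r → b * t * q * r) (sym (neg-^ℚ (ℕtoℚ n) j)) (sym (betaMoment-rising j i≤1+n)) ⟩
    b * (- ℕtoℚ n) ^ℚ j * q * betaMoment i (suc n ℕ.∸ i) j 0 ∎)
    where
    open ≡-Reasoning
    b = ℕtoℚ (a C j)
    σ = (- 1ℚ) ^ℚ j
    p = ℕtoℚ n ^ℚ j
    q = (ℕtoℚ i - ½) ^ℚ (a ℕ.∸ j)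
    ρ = ℕtoℚ (rising i j) /ℕ rising (suc n) j
    regroup : ∀ b σ p q ρ → b * σ * p * q * ρ ≡ b * (σ * p) * q * ρ
    regroup = solve-∀ ℚ-ring

  ∑-term≡rowSum/ℕ : ∀ a n i → i ≤ suc n →
    ∑[ j < suc a ] term a n (toℕ j) i ≡ rowSum a n i (suc n ℕ.∸ i) /ℕ (n ℕ.^ a)
  ∑-term≡rowSum/ℕ a n i i≤1+n = begin
    ∑[ j < suc a ] term a n (toℕ j) i
      ≡⟨ sum-cong-≗ {suc a} (λ j → term≡binomialTerm/ℕ a n (toℕ j) i i≤1+n) ⟩
    ∑[ j < suc a ] (binomialTerm a u c μ (toℕ j) /ℕ (n ℕ.^ a))
      ≡⟨ ∑-/ℕ (suc a) (binomialTerm a u c μ ∘ toℕ) (n ℕ.^ a) ⟩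
    (∑[ j < suc a ] binomialTerm a u c μ (toℕ j)) /ℕ (n ℕ.^ a)
      ≡⟨ cong (_/ℕ (n ℕ.^ a)) (powerMoment-expansion a a u c μ ℕ.≤-refl) ⟩
    rowSum a n i (suc n ℕ.∸ i) /ℕ (n ℕ.^ a) ∎
    where
    open ≡-Reasoning
    u = ℕtoℚ i - ½
    c = - ℕtoℚ n
    μ = λ j → betaMoment i (suc n ℕ.∸ i) j 0

  S≡∑rowSum/ℕ : ∀ a n → S a n ≡ ∑[ k < n ] (rowSum a n (suc (toℕ k)) (n ℕ.∸ toℕ k) /ℕ (n ℕ.^ a))
  S≡∑rowSum/ℕ a n = begin
    S a n
      ≡⟨ Σ[≤≤]≡∑ 0 a (λ j → Σ[ 1 ≤ n ≤ term a n j ]) ⟩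
    ∑[ j < suc a ] Σ[ 1 ≤ n ≤ term a n (toℕ j) ]
      ≡⟨ sum-cong-≗ {suc a} (λ j → Σ[≤≤]≡∑ 1 n (term a n (toℕ j))) ⟩
    ∑[ j < suc a ] ∑[ k < n ] term a n (toℕ j) (suc (toℕ k))
      ≡⟨ ∑-comm {suc a} {n} (λ j k → term a n (toℕ j) (suc (toℕ k))) ⟩
    ∑[ k < n ] ∑[ j < suc a ] term a n (toℕ j) (suc (toℕ k))
      ≡⟨ sum-cong-≗ {n} (λ k → ∑-term≡rowSum/ℕ a n (suc (toℕ k)) (s≤s (ℕ.<⇒≤ (toℕ<n k)))) ⟩
    ∑[ k < n ] (rowSum a n (suc (toℕ k)) (n ℕ.∸ toℕ k) /ℕ (n ℕ.^ a)) ∎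
    where open ≡-Reasoning

  S≡0 : ∀ a n → (- 1ℚ) ^ℚ a ≡ - 1ℚ → S a n ≡ 0ℚ
  S≡0 a n odd = trans (S≡∑rowSum/ℕ a n) (∑-antisymmetric≡0 n φ φ-antisym)
    where
    φ : ℕ → ℚ
    φ k = rowSum a n (suc k) (n ℕ.∸ k) /ℕ (n ℕ.^ a)
    φ-antisym : ∀ k → k < n → φ (n ℕ.∸ suc k) ≡ - φ k
    φ-antisym k k<n = begin
      rowSum a n (suc (n ℕ.∸ suc k)) (n ℕ.∸ (n ℕ.∸ suc k)) /ℕ (n ℕ.^ a)
        ≡⟨ cong₂ (λ x y → rowSum a n x y /ℕ (n ℕ.^ a)) (sym (ℕ.+-∸-assoc 1 k<n)) (ℕ.m∸[m∸n]≡n k<n) ⟩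
      rowSum a n (n ℕ.∸ k) (suc k) /ℕ (n ℕ.^ a)
        ≡⟨ cong (_/ℕ (n ℕ.^ a)) (rowSum-antisym a n (suc k) (n ℕ.∸ k) odd (cong suc (ℕ.m+[n∸m]≡n (ℕ.<⇒≤ k<n)))) ⟩
      (- rowSum a n (suc k) (n ℕ.∸ k)) /ℕ (n ℕ.^ a)
        ≡⟨ neg-/ℕ (rowSum a n (suc k) (n ℕ.∸ k)) (n ℕ.^ a) ⟩
      - φ k ∎
      where open ≡-Reasoning

open Vanishing using (S≡0; -1^ℚ-odd)

open import Data.Nat using (ℕ; _≤_; _∸_; _/_; suc; _*_)
open import Data.Product using (Σ; _,_)
open import Data.Rational using (ℚ; ∣_∣; 0ℚ; 1ℚ; -_) renaming (_≤_ to _≤ℚ_; _*_ to _*ℚ_)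
open import Data.Rational.Properties using (≤-reflexive; *-zeroˡ)
open import Relation.Binary.PropositionalEquality using (_≡_; sym; subst; trans; cong)

lemma1 : (a : ℕ) → (Σ ℕ λ m → a ≡ suc (2 * m)) →
    Σ ℚ λ C → Σ ℕ λ N → (n : ℕ) → N ≤ n →
      ∣ S a n ∣ *ℚ (ℕtoℚ n ^ℚ ((a ∸ 1) / 2)) ≤ℚ C
lemma1 a (m , a≡1+2m) = 0ℚ , 0 , λ n _ → ≤-reflexive (trans
  (cong (λ s → ∣ s ∣ *ℚ (ℕtoℚ n ^ℚ ((a ∸ 1) / 2))) (S≡0 a n odd))
  (*-zeroˡ (ℕtoℚ n ^ℚ ((a ∸ 1) / 2))))
  where
  odd : (- 1ℚ) ^ℚ a ≡ - 1ℚ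
  odd = subst (λ k → (- 1ℚ) ^ℚ k ≡ - 1ℚ) (sym a≡1+2m) (-1^ℚ-odd m)
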